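{- Let $n\ge 1$ and let $\mathcal{P}$ be a partition of $[n]$. (i) If $\mathcal{P}\in\mathfrak{P}(T_{\mathrm{id}_n})$, then $\operatorname{gap}(\mathcal{P})\le |S(\mathcal{P})|$. (ii) If $\mathcal{P}$ has no class of size at least $2$, then $\operatorname{gap}(\mathcal{P})=0$. (iii) If $\mathcal{P}$ has exactly $s\ge 1$ classes of size at least $2$ and $\{P_1,\dots,P_k\}$ is a listing of the classes of $\mathcal{P}$ such that $|P_i|\ge 2$ exactly when $1\le i\le s$, then $\operatorname{gap}(\mathcal{P})=\sum_{i=1}^s\operatorname{gap}(P_i)$.
   Context: For a finite nonempty set $X$ of positive integers, $\operatorname{gap}(X)=\max X-\min X+1-|X|$; for a family $\mathcal{X}$ of disjoint such sets, $\operatorname{gap}(\mathcal{X})=\sum_{X\in\mathcal{X}}\operatorname{gap}(X)$. For a partition $\mathcal{P}$ of $[n]=\{1,\dots,n\}$, $S(\mathcal{P})=\{c:\{c\}\in\mathcal{P}\}$ is the set of elements forming singleton classes. $T_{\mathrm{id}_n}$ is the standard caterpillar: the semilabeled binary tree (all vertices of degree 1 or 3, leaves labeled bijectively by $[n]$) whose non-leaf vertices form a path $v_2,\dots,v_{n-1}$, with leaves $1,2$ attached to $v_2$, leaf $i$ attached to $v_i$ for $3\le i\le n-2$, and leaves $n-1,n$ attached to $v_{n-1}$ (for $n\le 3$ the unique tree with $n$ labeled leaves). $\mathfrak{P}(T)$ is the set of partitions of $[n]$ obtained by deleting some set of edges of $T$ and putting two leaf labels in the same class iff they lie in the same component of the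 resulting forest (components without leaves ignored). -}

module Defs where

open import Data.Nat using (ℕ; zero; suc; _+_; _∸_; _⊔_; _⊓_; _≤_; _<_; _≤?_)
open import Data.Bool using (Bool)
import Data.Bool as B
open import Data.Fin using (Fin; toℕ)
open import Data.Fin.Subset using (Subset; _∈_; _∩_; ∣_∣; Nonempty; Empty; ⁅_⁆)
open import Data.Fin.Subset.Properties using (_∈?_)
open import Data.List using (List; []; _∷_; _++_; map; foldr; filter; allFin; upTo; length)
open import Data.Nat.ListAction using (sum)
open import Data.List.Relation.Unary.All using (All)
open import Data.List.Relation.Unary.AllPairs using (AllPairs)
open import Data.List.Relation.Binary.Sublist.Propositional using (_⊆_)
import Data.List.Membership.Propositional as MemP
import Data.List.Membership.DecPropositional as MemD
open import Data.Vec.Properties using (≡-dec)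
open import Data.Product using (_×_; _,_; ∃; Σ)
open import Data.Sum using (_⊎_; inj₁; inj₂)
open import Relation.Binary.PropositionalEquality using (_≡_)
open import Function.Bundles using (_⇔_)
open import Relation.Nullary using (Dec)

-- Elements of [n] are represented by Fin n; the element i : Fin n stands for
-- the positive integer  label i = toℕ i + 1.
label : ∀ {n} → Fin n → ℕ
label i = suc (toℕ i)

elems : ∀ {n} → Subset n → List ℕ
elems {n} X = map label (filter (_∈? X) (allFin n))

maxL : List ℕ → ℕ
maxL = foldr _⊔_ 0

minL : List ℕ → ℕ
minL []       = 0
minL (x ∷ xs) = foldr _⊓_ x xs

-- gap(X) = max X - min X + 1 - |X|   (X is nonempty in all uses)
gap : ∀ {n} → Subset n → ℕ
gap X = suc (maxL (elems X) ∸ minL (elems X)) ∸ ∣ X ∣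

gapF : ∀ {n} → List (Subset n) → ℕ
gapF 𝒳 = sum (map gap 𝒳)

-- A partition of [n], given as a list of its classes: nonempty, pairwise
-- disjoint (hence pairwise distinct), and covering [n].
record IsPartition {n : ℕ} (𝒫 : List (Subset n)) : Set where
  field
    nonempty : All Nonempty 𝒫
    disjoint : AllPairs (λ X Y → Empty (X ∩ Y)) 𝒫
    covers   : ∀ (i : Fin n) → ∃ λ X → (X MemP.∈ 𝒫) × (i ∈ X)

_≟S_ : ∀ {n} (X Y : Subset n) → Dec (X ≡ Y)
_≟S_ = ≡-dec B._≟_


S : ∀ {n} → List (Subset n) → List (Fin n)
S {n} 𝒫 = filter (λ c → MemD._∈?_ _≟S_ ⁅ c ⁆ 𝒫) (allFin n)

SameClass : ∀ {n} → List (Subset n) → Fin n → Fin n → Set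
SameClass 𝒫 i j = ∃ λ X → (X MemP.∈ 𝒫) × (i ∈ X) × (j ∈ X)

data Conn {V : Set} (F : List (V × V)) : V → V → Set where
  here : ∀ {x} → Conn F x x
  step : ∀ {x y z} → ((x , y) MemP.∈ F ⊎ (y , x) MemP.∈ F) → Conn F y z → Conn F x z

-- 𝔓(T) for a semilabeled tree T with vertex type V, edge list E and leaf
-- labelling leaf : Fin n → V.  𝒫 ∈ 𝔓(T) iff there is a set F ⊆ E of kept
-- edges (the complement is deleted) such that two leaf labels lie in the same
-- class of 𝒫 iff they are in the same component of (V, F).
InFrakP : ∀ {n} {V : Set} (E : List (V × V)) (leaf : Fin n → V) → List (Subset n) → Set
InFrakP {n} E leaf 𝒫 =
  ∃ λ F → (F ⊆ E) × (∀ (i j : Fin n) → SameClass 𝒫 i j ⇔ Conn F (leaf i) (leaf j))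

-- The standard caterpillar T_{id_n}.
-- Vertices: inj₁ i is the leaf labelled i (i ∈ [n], 1-based),
--           inj₂ j is the internal vertex v_j.

CatV : Set
CatV = ℕ ⊎ ℕ

L I : ℕ → CatV
L = inj₁
I = inj₂

catEdges : ℕ → List (CatV × CatV)
catEdges 0 = []
catEdges 1 = []
catEdges 2 = (L 1 , L 2) ∷ []
catEdges 3 = (L 1 , I 2) ∷ (L 2 , I 2) ∷ (L 3 , I 2) ∷ []
catEdges (suc (suc (suc (suc m)))) =
  (L 1 , I 2) ∷ (L 2 , I 2) ∷ (L (m + 3) , I (m + 3)) ∷ (L (m + 4) , I (m + 3)) ∷
  -- leaf i at v_i for 3 ≤ i ≤ n-2
  map (λ k → (L (3 + k) , I (3 + k))) (upTo m) ++
  -- path v_i — v_{i+1} for 2 ≤ i ≤ n-2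
  map (λ k → (I (2 + k) , I (3 + k))) (upTo (suc m))

catLeaf : ∀ {n} → Fin n → CatV
catLeaf i = L (label i)

InFrakPCat : ∀ n → List (Subset n) → Set
InFrakPCat n = InFrakP (catEdges n) catLeaf

module Submission where

-- Let the holes of a class X be the elements of [min X, max X] outside X, so that
-- gap X is their number. In a partition cut out of the caterpillar, a path between
-- leaves i < k passes the spine at j for every i < j < k; hence if j is a hole of
-- the class of i and k, leaf j reaches no other leaf and {j} is a class. Holes of
-- distinct classes are disjoint: if min X < min Y and j is a hole of both, then
-- min Y is a hole of X, so Y is a singleton and has no holes. Summing over classes
-- gives gap 𝒫 ≤ |S 𝒫|. Parts (ii) and (iii) only use that a class of size at most
-- one has gap 0, and that gap 𝒫 does not depend on the order of the classes.

open import Algebra.Definitions using (Selective)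
open import Data.Bool using (true; false)
open import Data.Empty using (⊥)
open import Data.Fin using (Fin; toℕ)
import Data.Fin as Fin
open import Data.Fin.Properties using (toℕ<n; toℕ-injective)
open import Data.Fin.Subset
  using (Subset; _∈_; _∉_; _⊆_; _∩_; _─_; ∣_∣; Nonempty; Empty; ⁅_⁆; inside; outside)
  renaming (⊥ to ∅)
open import Data.Fin.Subset.Properties
  using (_∈?_; ∉⊥; ∣⊥∣≡0; ∣⁅x⁆∣≡1; p⊆q⇒∣p∣≤∣q∣; ∣p∩q∣≤∣q∣; x∈p⇒∣p-x∣<∣p∣;
         x∈p∩q⁺; x∈p∩q⁻; ∩-comm; x∈p∧x∉q⇒x∈p─q; p─q⊆p; x∈p∧x≢y⇒x∈p-y;
         ⊆-antisym; x∈⁅x⁆; x∈⁅y⁆⇒x≡y)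
open import Data.List using (List; []; _∷_; map; filter; length; tabulate; allFin; upTo; lookup; take)
open import Data.List.Properties using (foldr-preservesᵇ; foldr-preservesᵒ; map-∘)
import Data.List.Membership.DecPropositional as MemD
open import Data.List.Membership.Propositional using () renaming (_∈_ to _∈ₗ_)
open import Data.List.Membership.Propositional.Properties
  using (∈-map⁺; ∈-map⁻; ∈-filter⁺; ∈-filter⁻; ∈-allFin)
open import Data.List.Relation.Binary.Permutation.Propositional using (_↭_; ↭-sym)
import Data.List.Relation.Binary.Permutation.Propositional.Properties as ↭
open import Data.List.Relation.Binary.Sublist.Propositional using () renaming (_⊆_ to _⊆ₗ_)
open import Data.List.Relation.Binary.Sublist.Propositional.Properties using (All-resp-⊆)
open import Data.List.Relation.Unary.All using (All; []; _∷_)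
import Data.List.Relation.Unary.All as All
import Data.List.Relation.Unary.All.Properties as All
open import Data.List.Relation.Unary.AllPairs using (AllPairs; []; _∷_)
import Data.List.Relation.Unary.AllPairs.Properties as AllPairs
open import Data.List.Relation.Unary.Any using (here; there)
import Data.List.Relation.Unary.Any as Any
open import Data.List.Relation.Unary.Any.Properties using (lookup-index)
open import Data.Nat using (ℕ; zero; suc; pred; _+_; _∸_; _≤_; _<_; z≤n; s≤s)
open import Data.Nat.ListAction using (sum)
open import Data.Nat.ListAction.Properties using (sum-↭)
open import Data.Nat.Properties
open import Data.Product using (_×_; _,_; ∃; proj₁; proj₂)
open import Data.Sum using (_⊎_; inj₁; inj₂; [_,_]; swap)
open import Data.Vec using ([]; _∷_; here; there)
import Data.Vec as Vec
open import Data.Vec.Properties using (lookup⇒[]=; lookup∘tabulate)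
open import Defs
open import Function using (_∘_; id)
open import Function.Bundles using (_⇔_; Equivalence; mk⇔)
open import Relation.Binary using (tri<; tri≈; tri>)
open import Relation.Binary.PropositionalEquality
  using (_≡_; _≢_; refl; sym; trans; cong; cong₂; subst; module ≡-Reasoning)
open import Relation.Nullary using (Dec; yes; no; does; contradiction)
open import Relation.Nullary.Decidable using (dec-true)
open import Relation.Unary using (Decidable)

private variable
  n : ℕ
  k : ℕ

selective⇒preserves : {_•_ : ℕ → ℕ → ℕ} → Selective _≡_ _•_ →
                      (P : ℕ → Set) {a b : ℕ} → P a → P b → P (a • b)
selective⇒preserves sel P {a} {b} pa pb =
  [ (λ eq → subst P (sym eq) pa) , (λ eq → subst P (sym eq) pb) ] (sel a b)

sum-map-mono : {A : Set} {f g : A → ℕ} {xs : List A} →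
               All (λ x → f x ≤ g x) xs → sum (map f xs) ≤ sum (map g xs)
sum-map-mono []                = z≤n
sum-map-mono (fx≤gx ∷ fxs≤gxs) = +-mono-≤ fx≤gx (sum-map-mono fxs≤gxs)

AllPairs-mapWith∈ : {A : Set} {R S : A → A → Set} {xs : List A} →
                    (∀ {x y} → x ∈ₗ xs → y ∈ₗ xs → R x y → S x y) → AllPairs R xs → AllPairs S xs
AllPairs-mapWith∈ f []         = []
AllPairs-mapWith∈ f (Rx ∷ Rxs) =
  All.tabulate (λ y∈ → f (here refl) (there y∈) (All.lookup Rx y∈))
  ∷ AllPairs-mapWith∈ (λ x∈ y∈ → f (there x∈) (there y∈)) Rxs

length-filter≡∣tabulate∣ : {A : Set} {P : A → Set} (P? : Decidable P) (f : Fin n → A) →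
                           length (filter P? (tabulate f)) ≡ ∣ Vec.tabulate (does ∘ P? ∘ f) ∣
length-filter≡∣tabulate∣ {zero}  P? f = refl
length-filter≡∣tabulate∣ {suc n} P? f with does (P? (f Fin.zero))
... | true  = cong suc (length-filter≡∣tabulate∣ P? (f ∘ Fin.suc))
... | false = length-filter≡∣tabulate∣ P? (f ∘ Fin.suc)

∣p∣≡∣p∩q∣+∣p─q∣ : (p q : Subset n) → ∣ p ∣ ≡ ∣ p ∩ q ∣ + ∣ p ─ q ∣
∣p∣≡∣p∩q∣+∣p─q∣ []            []            = refl
∣p∣≡∣p∩q∣+∣p─q∣ (outside ∷ p) (outside ∷ q) = ∣p∣≡∣p∩q∣+∣p─q∣ p q
∣p∣≡∣p∩q∣+∣p─q∣ (outside ∷ p) (inside  ∷ q) = ∣p∣≡∣p∩q∣+∣p─q∣ p q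
∣p∣≡∣p∩q∣+∣p─q∣ (inside  ∷ p) (inside  ∷ q) = cong suc (∣p∣≡∣p∩q∣+∣p─q∣ p q)
∣p∣≡∣p∩q∣+∣p─q∣ (inside  ∷ p) (outside ∷ q) =
  trans (cong suc (∣p∣≡∣p∩q∣+∣p─q∣ p q)) (sym (+-suc ∣ p ∩ q ∣ ∣ p ─ q ∣))

∣p∣∸∣q∣≤∣p─q∣ : (p q : Subset n) → ∣ p ∣ ∸ ∣ q ∣ ≤ ∣ p ─ q ∣
∣p∣∸∣q∣≤∣p─q∣ p q = begin
  ∣ p ∣ ∸ ∣ q ∣                          ≤⟨ ∸-monoʳ-≤ ∣ p ∣ (∣p∩q∣≤∣q∣ p q) ⟩
  ∣ p ∣ ∸ ∣ p ∩ q ∣                      ≡⟨ cong (_∸ ∣ p ∩ q ∣) (∣p∣≡∣p∩q∣+∣p─q∣ p q) ⟩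
  ∣ p ∩ q ∣ + ∣ p ─ q ∣ ∸ ∣ p ∩ q ∣      ≡⟨ m+n∸m≡n ∣ p ∩ q ∣ ∣ p ─ q ∣ ⟩
  ∣ p ─ q ∣                              ∎
  where open ≤-Reasoning

x∈p─q⇒x∉q : {p q : Subset n} {x : Fin n} → x ∈ p ─ q → x ∉ q
x∈p─q⇒x∉q {p = _ ∷ p} {outside ∷ q} (there x∈p─q) (there x∈q) = x∈p─q⇒x∉q x∈p─q x∈q
x∈p─q⇒x∉q {p = _ ∷ p} {inside  ∷ q} (there x∈p─q) (there x∈q) = x∈p─q⇒x∉q x∈p─q x∈q

x∈p⇒0<∣p∣ : {p : Subset n} {x : Fin n} → x ∈ p → 0 < ∣ p ∣
x∈p⇒0<∣p∣ {p = p} {x} x∈p = subst (_≤ ∣ p ∣) (∣⁅x⁆∣≡1 x) (p⊆q⇒∣p∣≤∣q∣ ⁅x⁆⊆p)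
  where
  ⁅x⁆⊆p : ⁅ x ⁆ ⊆ p
  ⁅x⁆⊆p y∈⁅x⁆ = subst (_∈ p) (sym (x∈⁅y⁆⇒x≡y x y∈⁅x⁆)) x∈p

2≤∣p∣ : {p : Subset n} {x y : Fin n} → x ∈ p → y ∈ p → x ≢ y → 2 ≤ ∣ p ∣
2≤∣p∣ x∈p y∈p x≢y = ≤-trans (s≤s (x∈p⇒0<∣p∣ (x∈p∧x≢y⇒x∈p-y y∈p (x≢y ∘ sym)))) (x∈p⇒∣p-x∣<∣p∣ x∈p)

Σ∣p∣≤∣q∣ : {ps : List (Subset n)} {q : Subset n} →
           AllPairs (λ p p′ → Empty (p ∩ p′)) ps → All (_⊆ q) ps → sum (map ∣_∣ ps) ≤ ∣ q ∣
Σ∣p∣≤∣q∣ [] [] = z≤n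
Σ∣p∣≤∣q∣ {ps = p ∷ ps} {q} (p#ps ∷ ps#) (p⊆q ∷ ps⊆q) = begin
  ∣ p ∣ + sum (map ∣_∣ ps)  ≤⟨ +-mono-≤ (p⊆q⇒∣p∣≤∣q∣ p⊆q∩p) (Σ∣p∣≤∣q∣ ps# ps⊆q─p) ⟩
  ∣ q ∩ p ∣ + ∣ q ─ p ∣      ≡⟨ ∣p∣≡∣p∩q∣+∣p─q∣ q p ⟨
  ∣ q ∣                      ∎
  where
  open ≤-Reasoning
  p⊆q∩p : p ⊆ q ∩ p
  p⊆q∩p x∈p = x∈p∩q⁺ (p⊆q x∈p , x∈p)
  ps⊆q─p : All (_⊆ q ─ p) ps
  ps⊆q─p = All.zipWith (λ (p#p′ , p′⊆q) {x} x∈p′ →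
             x∈p∧x∉q⇒x∈p─q (p′⊆q x∈p′) (λ x∈p → p#p′ (_ , x∈p∩q⁺ (x∈p , x∈p′))))
           (p#ps , ps⊆q)

disjoint-classes-unique : {𝒬 : List (Subset n)} {X Y : Subset n} {x : Fin n} →
                          AllPairs (λ X Y → Empty (X ∩ Y)) 𝒬 →
                          X ∈ₗ 𝒬 → Y ∈ₗ 𝒬 → x ∈ X → x ∈ Y → X ≡ Y
disjoint-classes-unique (_  ∷ _)  (here refl) (here refl) _   _   = refl
disjoint-classes-unique (X# ∷ _)  (here refl) (there Y∈)  x∈X x∈Y =
  contradiction (_ , x∈p∩q⁺ (x∈X , x∈Y)) (All.lookup X# Y∈)
disjoint-classes-unique (Y# ∷ _)  (there X∈)  (here refl) x∈X x∈Y =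
  contradiction (_ , x∈p∩q⁺ (x∈Y , x∈X)) (All.lookup Y# X∈)
disjoint-classes-unique (_  ∷ #s) (there X∈)  (there Y∈)  x∈X x∈Y =
  disjoint-classes-unique #s X∈ Y∈ x∈X x∈Y

-- prefix k = {1, …, k} in the 1-based labelling, i.e. {j | toℕ j < k}.
prefix : ℕ → Subset n
prefix {zero}  _       = []
prefix {suc n} zero    = ∅
prefix {suc n} (suc k) = inside ∷ prefix k

∣prefix∣ : k ≤ n → ∣ prefix {n} k ∣ ≡ k
∣prefix∣ {n = zero}       z≤n       = refl
∣prefix∣ {zero}  {suc n} _         = ∣⊥∣≡0 (suc n)
∣prefix∣ {suc k} {suc n} (s≤s k≤n) = cong suc (∣prefix∣ k≤n)

x∈prefix⇒x<k : {x : Fin n} → x ∈ prefix k → toℕ x < k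
x∈prefix⇒x<k {suc n} {zero}  x∈⊥           = contradiction x∈⊥ ∉⊥
x∈prefix⇒x<k {suc n} {suc k} here          = s≤s z≤n
x∈prefix⇒x<k {suc n} {suc k} (there x∈pre) = s≤s (x∈prefix⇒x<k x∈pre)

x<k⇒x∈prefix : {x : Fin n} → toℕ x < k → x ∈ prefix k
x<k⇒x∈prefix {suc n} {suc k} {Fin.zero}  _         = here
x<k⇒x∈prefix {suc n} {suc k} {Fin.suc x} (s≤s x<k) = there (x<k⇒x∈prefix x<k)

module _ {xs : List ℕ} {x : ℕ} (x∈xs : x ∈ₗ xs) where

  ≤maxL : x ≤ maxL xs
  ≤maxL = foldr-preservesᵒ (λ a b → [ m≤n⇒m≤n⊔o b , m≤n⇒m≤o⊔n a ]) 0 xs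
            (inj₂ (Any.map ≤-reflexive x∈xs))

  -- maxL starts its fold from the junk value 0, which a positive element rules out.
  maxL∈ : 0 < x → maxL xs ∈ₗ xs
  maxL∈ 0<x with foldr-preservesᵇ (selective⇒preserves ⊔-sel (λ m → m ≡ 0 ⊎ m ∈ₗ xs))
                   (inj₁ refl) (All.tabulate inj₂)
  ... | inj₁ max≡0 = contradiction (subst (0 <_) max≡0 (<-≤-trans 0<x ≤maxL)) (<-irrefl refl)
  ... | inj₂ max∈  = max∈

minL≤ : {xs : List ℕ} {x : ℕ} → x ∈ₗ xs → minL xs ≤ x
minL≤ {y ∷ ys} {x} x∈xs = foldr-preservesᵒ (λ a b → [ m≤n⇒m⊓o≤n b , m≤n⇒o⊓m≤n a ]) y ys
                            (Any.toSum (Any.map (≤-reflexive ∘ sym) x∈xs))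

minL∈ : {xs : List ℕ} {x : ℕ} → x ∈ₗ xs → minL xs ∈ₗ xs
minL∈ {y ∷ ys} _ =
  foldr-preservesᵇ (selective⇒preserves ⊓-sel (_∈ₗ y ∷ ys)) (here refl) (All.tabulate there)

∈-elems⁺ : {X : Subset n} {j : Fin n} → j ∈ X → label j ∈ₗ elems X
∈-elems⁺ {n} {X} {j} j∈X = ∈-map⁺ label (∈-filter⁺ (_∈? X) (∈-allFin j) j∈X)

∈-elems⁻ : {X : Subset n} {v : ℕ} → v ∈ₗ elems X → ∃ λ j → j ∈ X × v ≡ label j
∈-elems⁻ {n} {X} v∈ with ∈-map⁻ label v∈
... | j , j∈ , v≡ = j , proj₂ (∈-filter⁻ (_∈? X) {xs = allFin n} j∈) , v≡

record Bounds (X : Subset n) : Set where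
  field
    lo hi   : Fin n
    lo∈X    : lo ∈ X
    hi∈X    : hi ∈ X
    minL≡lo : minL (elems X) ≡ label lo
    maxL≡hi : maxL (elems X) ≡ label hi
    lo≤     : ∀ {j} → j ∈ X → toℕ lo ≤ toℕ j
    ≤hi     : ∀ {j} → j ∈ X → toℕ j ≤ toℕ hi

bounds : {X : Subset n} → Nonempty X → Bounds X
bounds {X = X} (x , x∈X)
  with ∈-elems⁻ (minL∈ (∈-elems⁺ x∈X)) | ∈-elems⁻ (maxL∈ (∈-elems⁺ x∈X) (s≤s z≤n))
... | lo , lo∈X , min≡ | hi , hi∈X , max≡ = record
  { lo = lo ; hi = hi ; lo∈X = lo∈X ; hi∈X = hi∈X ; minL≡lo = min≡ ; maxL≡hi = max≡
  ; lo≤ = λ j∈X → ≤-pred (subst (_≤ _) min≡ (minL≤ (∈-elems⁺ j∈X)))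
  ; ≤hi = λ j∈X → ≤-pred (subst (_ ≤_) max≡ (≤maxL (∈-elems⁺ j∈X)))
  }

hull : Subset n → Subset n
hull X = prefix (maxL (elems X)) ─ prefix (pred (minL (elems X)))

holes : Subset n → Subset n
holes X = hull X ─ X

module _ {X : Subset n} (b : Bounds X) where
  open Bounds b

  hull≡ : hull X ≡ prefix (suc (toℕ hi)) ─ prefix (toℕ lo)
  hull≡ = cong₂ (λ M m → prefix M ─ prefix (pred m)) maxL≡hi minL≡lo

  gap≡ : gap X ≡ suc (toℕ hi ∸ toℕ lo) ∸ ∣ X ∣
  gap≡ = cong₂ (λ M m → suc (M ∸ m) ∸ ∣ X ∣) maxL≡hi minL≡lo

  gap≤∣holes∣ : gap X ≤ ∣ holes X ∣
  gap≤∣holes∣ = begin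
    gap X                                        ≡⟨ gap≡ ⟩
    suc (toℕ hi ∸ toℕ lo) ∸ ∣ X ∣                ≡⟨ cong (_∸ ∣ X ∣) (+-∸-assoc 1 (lo≤ hi∈X)) ⟨
    suc (toℕ hi) ∸ toℕ lo ∸ ∣ X ∣                ≡⟨ cong₂ (λ a b → a ∸ b ∸ ∣ X ∣)
                                                      (∣prefix∣ (toℕ<n hi)) (∣prefix∣ (<⇒≤ (toℕ<n lo))) ⟨
    ∣ upToHi ∣ ∸ ∣ belowLo ∣ ∸ ∣ X ∣             ≤⟨ ∸-monoˡ-≤ ∣ X ∣ (∣p∣∸∣q∣≤∣p─q∣ upToHi belowLo) ⟩
    ∣ upToHi ─ belowLo ∣ ∸ ∣ X ∣                 ≤⟨ ∣p∣∸∣q∣≤∣p─q∣ (upToHi ─ belowLo) X ⟩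
    ∣ upToHi ─ belowLo ─ X ∣                     ≡⟨ cong (λ h → ∣ h ─ X ∣) hull≡ ⟨
    ∣ holes X ∣                                  ∎
    where
    open ≤-Reasoning
    upToHi belowLo : Subset n
    upToHi  = prefix (suc (toℕ hi))
    belowLo = prefix (toℕ lo)

  ∣X∣<2⇒lo≡hi : ∣ X ∣ < 2 → lo ≡ hi
  ∣X∣<2⇒lo≡hi ∣X∣<2 with lo Fin.≟ hi
  ... | yes lo≡hi = lo≡hi
  ... | no  lo≢hi = contradiction (2≤∣p∣ lo∈X hi∈X lo≢hi) (<⇒≱ ∣X∣<2)

  gap≡0 : ∣ X ∣ < 2 → gap X ≡ 0
  gap≡0 ∣X∣<2 = begin
    gap X                          ≡⟨ gap≡ ⟩
    suc (toℕ hi ∸ toℕ lo) ∸ ∣ X ∣  ≡⟨ cong (λ h → suc (toℕ h ∸ toℕ lo) ∸ ∣ X ∣)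
                                            (∣X∣<2⇒lo≡hi ∣X∣<2) ⟨
    suc (toℕ lo ∸ toℕ lo) ∸ ∣ X ∣  ≡⟨ cong (λ d → suc d ∸ ∣ X ∣) (n∸n≡0 (toℕ lo)) ⟩
    1 ∸ ∣ X ∣                      ≡⟨ m≤n⇒m∸n≡0 (x∈p⇒0<∣p∣ lo∈X) ⟩
    0                              ∎
    where open ≡-Reasoning

  holes⊆interior : {j : Fin n} → j ∈ holes X → toℕ lo < toℕ j × toℕ j < toℕ hi × j ∉ X
  holes⊆interior {j} j∈holes = lo<j , j<hi , j∉X
    where
    j∉X : j ∉ X
    j∉X = x∈p─q⇒x∉q j∈holes
    j∈hull : j ∈ prefix (suc (toℕ hi)) ─ prefix (toℕ lo)
    j∈hull = subst (j ∈_) hull≡ (p─q⊆p _ X j∈holes)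
    ≢j : {i : Fin n} → i ∈ X → toℕ i ≢ toℕ j
    ≢j i∈X i≡j = j∉X (subst (_∈ X) (toℕ-injective i≡j) i∈X)
    lo<j : toℕ lo < toℕ j
    lo<j = ≤∧≢⇒< (≮⇒≥ (x∈p─q⇒x∉q j∈hull ∘ x<k⇒x∈prefix)) (≢j lo∈X)
    j<hi : toℕ j < toℕ hi
    j<hi = ≤∧≢⇒< (≤-pred (x∈prefix⇒x<k (p─q⊆p _ _ j∈hull))) (≢j hi∈X ∘ sym)

_∈ₗ?_ : (X : Subset n) (𝒫 : List (Subset n)) → Dec (X ∈ₗ 𝒫)
X ∈ₗ? 𝒫 = MemD._∈?_ _≟S_ X 𝒫

singletons : List (Subset n) → Subset n
singletons 𝒫 = Vec.tabulate (λ c → does (⁅ c ⁆ ∈ₗ? 𝒫))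

∈-singletons⁺ : {𝒫 : List (Subset n)} {j : Fin n} → ⁅ j ⁆ ∈ₗ 𝒫 → j ∈ singletons 𝒫
∈-singletons⁺ {𝒫 = 𝒫} {j} ⁅j⁆∈𝒫 =
  lookup⇒[]= j _ (trans (lookup∘tabulate _ j) (dec-true (⁅ j ⁆ ∈ₗ? 𝒫) ⁅j⁆∈𝒫))

length-S≡∣singletons∣ : (𝒫 : List (Subset n)) → length (S 𝒫) ≡ ∣ singletons 𝒫 ∣
length-S≡∣singletons∣ 𝒫 = length-filter≡∣tabulate∣ (λ c → ⁅ c ⁆ ∈ₗ? 𝒫) (λ c → c)

HolesAreSingletons : List (Subset n) → Set
HolesAreSingletons 𝒫 = ∀ {X i j k} → X ∈ₗ 𝒫 → i ∈ X → k ∈ X → j ∉ X →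
                       toℕ i < toℕ j → toℕ j < toℕ k → ⁅ j ⁆ ∈ₗ 𝒫

module _ {𝒫 : List (Subset n)} (isP : IsPartition 𝒫) where
  open IsPartition isP

  class-unique : {X Y : Subset n} {x : Fin n} → X ∈ₗ 𝒫 → Y ∈ₗ 𝒫 → x ∈ X → x ∈ Y → X ≡ Y
  class-unique = disjoint-classes-unique disjoint

  singleton-class : {j : Fin n} → (∀ l → SameClass 𝒫 j l → l ≡ j) → ⁅ j ⁆ ∈ₗ 𝒫
  singleton-class {j} alone with covers j
  ... | Z , Z∈𝒫 , j∈Z = subst (_∈ₗ 𝒫) Z≡⁅j⁆ Z∈𝒫
    where
    Z≡⁅j⁆ : Z ≡ ⁅ j ⁆
    Z≡⁅j⁆ = ⊆-antisym
      (λ {l} l∈Z → subst (_∈ ⁅ j ⁆) (sym (alone l (Z , Z∈𝒫 , j∈Z , l∈Z))) (x∈⁅x⁆ j))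
      (λ l∈⁅j⁆ → subst (_∈ Z) (sym (x∈⁅y⁆⇒x≡y j l∈⁅j⁆)) j∈Z)

  bounds-of : {X : Subset n} → X ∈ₗ 𝒫 → Bounds X
  bounds-of X∈𝒫 = bounds (All.lookup nonempty X∈𝒫)

  module _ (holes-singleton : HolesAreSingletons 𝒫) where

    holes⊆singletons : {X : Subset n} → X ∈ₗ 𝒫 → holes X ⊆ singletons 𝒫
    holes⊆singletons X∈𝒫 j∈holes with holes⊆interior (bounds-of X∈𝒫) j∈holes
    ... | lo<j , j<hi , j∉X = ∈-singletons⁺ (holes-singleton X∈𝒫 lo∈X hi∈X j∉X lo<j j<hi)
      where open Bounds (bounds-of X∈𝒫)

    holes-disjoint-< : {X Y : Subset n} {j : Fin n} (X∈𝒫 : X ∈ₗ 𝒫) (Y∈𝒫 : Y ∈ₗ 𝒫) → Empty (X ∩ Y) →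
                       toℕ (Bounds.lo (bounds-of X∈𝒫)) < toℕ (Bounds.lo (bounds-of Y∈𝒫)) →
                       j ∈ holes X → j ∈ holes Y → ⊥
    holes-disjoint-< {X} {Y} X∈𝒫 Y∈𝒫 X#Y loX<loY j∈holesX j∈holesY
      with holes⊆interior (bounds-of X∈𝒫) j∈holesX | holes⊆interior (bounds-of Y∈𝒫) j∈holesY
    ... | _ , j<hiX , _ | loY<j , j<hiY , _ = <-irrefl (sym hiY≡loY) (<-trans loY<j j<hiY)
      where
      module BX = Bounds (bounds-of X∈𝒫)
      module BY = Bounds (bounds-of Y∈𝒫)
      loY∉X : BY.lo ∉ X
      loY∉X loY∈X = X#Y (_ , x∈p∩q⁺ (loY∈X , BY.lo∈X))
      ⁅loY⁆≡Y : ⁅ BY.lo ⁆ ≡ Y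
      ⁅loY⁆≡Y = class-unique
        (holes-singleton X∈𝒫 BX.lo∈X BX.hi∈X loY∉X loX<loY (<-trans loY<j j<hiX))
        Y∈𝒫 (x∈⁅x⁆ BY.lo) BY.lo∈X
      hiY≡loY : toℕ BY.hi ≡ toℕ BY.lo
      hiY≡loY = cong toℕ (x∈⁅y⁆⇒x≡y BY.lo (subst (BY.hi ∈_) (sym ⁅loY⁆≡Y) BY.hi∈X))

    holes-disjoint : {X Y : Subset n} → X ∈ₗ 𝒫 → Y ∈ₗ 𝒫 → Empty (X ∩ Y) → Empty (holes X ∩ holes Y)
    holes-disjoint {X} {Y} X∈𝒫 Y∈𝒫 X#Y (j , j∈∩)
      with x∈p∩q⁻ (holes X) (holes Y) j∈∩
         | <-cmp (toℕ (Bounds.lo (bounds-of X∈𝒫))) (toℕ (Bounds.lo (bounds-of Y∈𝒫)))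
    ... | j∈holesX , j∈holesY | tri< loX<loY _ _ =
      holes-disjoint-< X∈𝒫 Y∈𝒫 X#Y loX<loY j∈holesX j∈holesY
    ... | j∈holesX , j∈holesY | tri> _ _ loY<loX =
      holes-disjoint-< Y∈𝒫 X∈𝒫 (subst Empty (∩-comm X Y) X#Y) loY<loX j∈holesY j∈holesX
    ... | _ | tri≈ _ loX≡loY _ =
      X#Y (_ , x∈p∩q⁺ (Bounds.lo∈X (bounds-of X∈𝒫) ,
                       subst (_∈ Y) (sym (toℕ-injective loX≡loY)) (Bounds.lo∈X (bounds-of Y∈𝒫))))

    gapF≤∣S∣ : gapF 𝒫 ≤ length (S 𝒫)
    gapF≤∣S∣ = begin
      gapF 𝒫                      ≤⟨ sum-map-mono (All.tabulate (gap≤∣holes∣ ∘ bounds-of)) ⟩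
      sum (map (∣_∣ ∘ holes) 𝒫)   ≡⟨ cong sum (map-∘ 𝒫) ⟩
      sum (map ∣_∣ (map holes 𝒫)) ≤⟨ Σ∣p∣≤∣q∣ (AllPairs.map⁺ (AllPairs-mapWith∈ holes-disjoint disjoint))
                                              (All.map⁺ (All.tabulate holes⊆singletons)) ⟩
      ∣ singletons 𝒫 ∣            ≡⟨ length-S≡∣singletons∣ 𝒫 ⟨
      length (S 𝒫)                ∎
      where open ≤-Reasoning

module _ {V : Set} {F : List (V × V)} where

  Conn-trans : {x y z : V} → Conn F x y → Conn F y z → Conn F x z
  Conn-trans here        y⇝z = y⇝z
  Conn-trans (step e x⇝y) y⇝z = step e (Conn-trans x⇝y y⇝z)

  Conn-sym : {x y : V} → Conn F x y → Conn F y x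
  Conn-sym here         = here
  Conn-sym (step e x⇝y) = Conn-trans (Conn-sym x⇝y) (step (swap e) here)

-- The caterpillar vertices L i and I i both sit at position i along the spine.
position : CatV → ℕ
position = [ id , id ]

Short : CatV × CatV → Set
Short (u , v) = position u ≤ suc (position v) × position v ≤ suc (position u)

catEdges-short : ∀ n → All Short (catEdges n)
catEdges-short 0 = []
catEdges-short 1 = []
catEdges-short 2 = (s≤s z≤n , ≤-refl) ∷ []
catEdges-short 3 = (s≤s z≤n , ≤-refl) ∷ (n≤1+n _ , n≤1+n _) ∷ (≤-refl , s≤s (s≤s z≤n)) ∷ []
catEdges-short (suc (suc (suc (suc m)))) =
  (s≤s z≤n , ≤-refl) ∷ (n≤1+n _ , n≤1+n _) ∷ (n≤1+n _ , n≤1+n _) ∷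
  (≤-reflexive (+-suc m 3) , m≤n⇒m≤1+n (+-monoʳ-≤ m (n≤1+n 3))) ∷
  All.++⁺ (All.map⁺ (All.universal (λ _ → n≤1+n _ , n≤1+n _) (upTo m)))
          (All.map⁺ (All.universal (λ _ → m≤n⇒m≤1+n (n≤1+n _) , ≤-refl) (upTo (suc m))))

Conn-short-crosses : {F : List (CatV × CatV)} → All Short F → {x z : CatV} (m : ℕ) →
                     Conn F x z → position x < m → m < position z →
                     ∃ λ w → position w ≡ m × Conn F x w
Conn-short-crosses short m here x<m m<x = contradiction x<m (<-asym m<x)
Conn-short-crosses {F} short {x} m (step {y = y} e y⇝z) x<m m<z
  with m≤n⇒m<n∨m≡n (≤-trans (short-step e) x<m)
  where
  short-step : (x , y) ∈ₗ F ⊎ (y , x) ∈ₗ F → position y ≤ suc (position x)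
  short-step (inj₁ xy∈F) = proj₂ (All.lookup short xy∈F)
  short-step (inj₂ yx∈F) = proj₁ (All.lookup short yx∈F)
... | inj₂ y≡m = y , y≡m , step e here
... | inj₁ y<m with Conn-short-crosses short m y⇝z y<m m<z
...   | w , w≡m , y⇝w = w , w≡m , step e y⇝w

-- Edges of catEdges list the leaf first, so this says the only edge at leaf j is (L j , I j).
PendantAt : ℕ → CatV × CatV → Set
PendantAt j (u , v) = (u ≡ L j → v ≡ I j) × v ≢ L j

catEdges-pendantAt : ∀ n j → 2 ≤ j → j < n → All (PendantAt j) (catEdges n)
catEdges-pendantAt 0 _ _ _ = []
catEdges-pendantAt 1 _ _ _ = []
catEdges-pendantAt 2 j 2≤j j<2 = contradiction (<-≤-trans j<2 2≤j) (<-irrefl refl)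
catEdges-pendantAt 3 j 2≤j j<3 =
  ((λ { refl → contradiction 2≤j λ { (s≤s ()) } }) , λ ()) ∷ spine 2 ∷
  ((λ { refl → contradiction j<3 (<-irrefl refl) }) , λ ()) ∷ []
  where
  spine : ∀ a → PendantAt j (L a , I a)
  spine a = (λ { refl → refl }) , λ ()
catEdges-pendantAt (suc (suc (suc (suc m)))) j 2≤j j<n =
  ((λ { refl → contradiction 2≤j λ { (s≤s ()) } }) , λ ()) ∷ spine 2 ∷ spine (m + 3) ∷
  ((λ { refl → contradiction (subst (j <_) (+-comm 4 m) j<n) (<-irrefl refl) }) , λ ()) ∷
  All.++⁺ (All.map⁺ (All.universal (λ k → spine (3 + k)) (upTo m)))
          (All.map⁺ (All.universal (λ _ → (λ ()) , (λ ())) (upTo (suc m))))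
  where
  spine : ∀ a → PendantAt j (L a , I a)
  spine a = (λ { refl → refl }) , λ ()

Conn-pendant : {F : List (CatV × CatV)} {j b : ℕ} → All (PendantAt j) F →
               Conn F (L j) (L b) → b ≢ j → Conn F (L j) (I j)
Conn-pendant pend here b≢j = contradiction refl b≢j
Conn-pendant {F} {j} pend (step (inj₁ e) _) _ =
  step (inj₁ (subst (λ v → (L j , v) ∈ₗ F) (proj₁ (All.lookup pend e) refl) e)) here
Conn-pendant pend (step (inj₂ e) _) _ = contradiction refl (proj₂ (All.lookup pend e))

-- A path from leaf a to leaf c passes position b, i.e. leaf b or the vertex I b;
-- in the second case leaf b reaches I b as soon as it reaches any other leaf.
caterpillar-path-via : {n a b c d : ℕ} {F : List (CatV × CatV)} → F ⊆ₗ catEdges n →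
                       0 < a → a < b → b < c → c ≤ n →
                       Conn F (L a) (L c) → Conn F (L b) (L d) → d ≢ b → Conn F (L a) (L b)
caterpillar-path-via {n} {b = b} F⊆E 0<a a<b b<c c≤n a⇝c b⇝d d≢b
  with Conn-short-crosses (All-resp-⊆ F⊆E (catEdges-short n)) b a⇝c a<b b<c
... | inj₁ _ , refl , a⇝b  = a⇝b
... | inj₂ _ , refl , a⇝Ib = Conn-trans a⇝Ib (Conn-sym (Conn-pendant pendant b⇝d d≢b))
  where
  pendant = All-resp-⊆ F⊆E (catEdges-pendantAt n b (≤-trans (s≤s 0<a) a<b) (<-≤-trans b<c c≤n))

caterpillar-holesAreSingletons : {𝒫 : List (Subset n)} → IsPartition 𝒫 → InFrakPCat n 𝒫 →
                                 HolesAreSingletons 𝒫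
caterpillar-holesAreSingletons {n} {𝒫} isP (F , F⊆E , same⇔conn) {X} {i} {j} {k}
                               X∈𝒫 i∈X k∈X j∉X i<j j<k = singleton-class isP alone
  where
  i⇝j : ∀ {l} → l ≢ j → SameClass 𝒫 j l → Conn F (catLeaf i) (catLeaf j)
  i⇝j {l} l≢j j~l = caterpillar-path-via F⊆E (s≤s z≤n) (s≤s i<j) (s≤s j<k) (toℕ<n k)
                      (Equivalence.to (same⇔conn i k) (X , X∈𝒫 , i∈X , k∈X))
                      (Equivalence.to (same⇔conn j l) j~l)
                      (l≢j ∘ toℕ-injective ∘ suc-injective)
  alone : ∀ l → SameClass 𝒫 j l → l ≡ j
  alone l j~l with l Fin.≟ j
  ... | yes l≡j = l≡j
  ... | no  l≢j with Equivalence.from (same⇔conn i j) (i⇝j l≢j j~l)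
  ...   | Y , Y∈𝒫 , i∈Y , j∈Y =
    contradiction (subst (j ∈_) (class-unique isP Y∈𝒫 X∈𝒫 i∈Y i∈X) j∈Y) j∉X

gapF≡0 : {𝒳 : List (Subset n)} → All Nonempty 𝒳 → All (λ X → ∣ X ∣ < 2) 𝒳 → gapF 𝒳 ≡ 0
gapF≡0 []         []           = refl
gapF≡0 (ne ∷ nes) (∣X∣<2 ∷ lts) = cong₂ _+_ (gap≡0 (bounds ne) ∣X∣<2) (gapF≡0 nes lts)

gapF≡Σtake : {Q : List (Subset n)} (s : ℕ) → All Nonempty Q →
             (∀ (i : Fin (length Q)) → (2 ≤ ∣ lookup Q i ∣) ⇔ (toℕ i < s)) →
             gapF Q ≡ sum (map gap (take s Q))
gapF≡Σtake {Q = Q}     zero    nes        large⇔ = gapF≡0 nes (All.tabulate small)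
  where
  small : ∀ {X} → X ∈ₗ Q → ∣ X ∣ < 2
  small X∈Q = subst (λ Y → ∣ Y ∣ < 2) (sym (lookup-index X∈Q))
                    (≰⇒> (n≮0 ∘ Equivalence.to (large⇔ (Any.index X∈Q))))
gapF≡Σtake {Q = []}    (suc s) []         _      = refl
gapF≡Σtake {Q = X ∷ Q} (suc s) (_ ∷ nes) large⇔ = cong (gap X +_) (gapF≡Σtake s nes large⇔′)
  where
  large⇔′ : ∀ (i : Fin (length Q)) → (2 ≤ ∣ lookup Q i ∣) ⇔ (toℕ i < s)
  large⇔′ i = mk⇔ (≤-pred ∘ Equivalence.to (large⇔ (Fin.suc i)))
                  (Equivalence.from (large⇔ (Fin.suc i)) ∘ s≤s)

gapF-↭ : {𝒳 𝒴 : List (Subset n)} → 𝒳 ↭ 𝒴 → gapF 𝒳 ≡ gapF 𝒴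
gapF-↭ 𝒳↭𝒴 = sum-↭ (↭.map⁺ gap 𝒳↭𝒴)

lemma5p1 : ∀ (n : ℕ) → 1 ≤ n → (𝒫 : List (Subset n)) → IsPartition 𝒫 →
      (InFrakPCat n 𝒫 → gapF 𝒫 ≤ length (S 𝒫))
    × (All (λ X → ∣ X ∣ < 2) 𝒫 → gapF 𝒫 ≡ 0)
    × (∀ (s : ℕ) → 1 ≤ s → length (filter (λ X → 2 ≤? ∣ X ∣) 𝒫) ≡ s →
        ∀ (Q : List (Subset n)) → Q ↭ 𝒫 →
        (∀ (i : Fin (length Q)) → (2 ≤ ∣ lookup Q i ∣) ⇔ (toℕ i < s)) →
        gapF 𝒫 ≡ sum (map gap (take s Q)))
lemma5p1 n _ 𝒫 isP =
    (λ 𝒫∈𝔓 → gapF≤∣S∣ isP (caterpillar-holesAreSingletons isP 𝒫∈𝔓))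
  , gapF≡0 nonempty
  , λ s _ _ Q Q↭𝒫 large⇔ →
      trans (gapF-↭ (↭-sym Q↭𝒫)) (gapF≡Σtake s (↭.All-resp-↭ (↭-sym Q↭𝒫) nonempty) large⇔)
  where open IsPartition isP
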